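{- Let $K$ be a field, $n\ge1$, $\mathbf{q}=(q_1,\dots,q_n)$ formal variables with $q_1\cdots q_n=1$, and $\gamma=(1,2,\dots,n)\in S_n$ the $n$-cycle. For all $\sigma,\tau\in S_n$ and all integers $i\ge0$ the following identities hold in $K(\mathbf{q})$: (i) $\gamma\cdot N(\sigma)=q_1\,N(\gamma\sigma)$; (ii) $\tau\cdot D_{\mathbf{q}}(\sigma)=D_{\mathbf{q}}(\tau\sigma)$; (iii) $\gamma^i\cdot\mu(\sigma)=q_1q_2\cdots q_i\,\mu(\gamma^i\sigma)$; (iv) $N(\sigma\gamma^i)=(q_{\sigma(1)}\cdots q_{\sigma(i)})^{ -\bar d(\sigma)}\,N(\sigma)$.
   Context: $K(\mathbf{q})$ is the field of rational functions over $K$ in $q_1,\dots,q_{n-1}$, with $q_n:=(q_1\cdots q_{n-1})^{ -1}$. $S_n$ acts on $K(\mathbf{q})$ by $\sigma\cdot f(q_1,\dots,q_n)=f(q_{\sigma(1)},\dots,q_{\sigma(n)})$; permutations are composed right to left ($(\gamma\sigma)(i)=\gamma(\sigma(i))$), and $\gamma(k)=k+1$ for $k<n$, $\gamma(n)=1$. For $\sigma\in S_n$: $D(\sigma)=\{j:1\le j\le n-1,\ \sigma(j)>\sigma(j+1)\}$, $d(\sigma)=|D(\sigma)|$; the circular descent number is $\bar d(\sigma)=d(\sigma)$ if $\sigma(n)<\sigma(1)$ and $\bar d(\sigma)=d(\sigma)+1$ if $\sigma(n)>\sigma(1)$. Define $N(\sigma)=\prod_{j\in D(\sigma)}q_{\sigma(1)}\cdots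 q_{\sigma(j)}$, $D_{\mathbf{q}}(\sigma)=\prod_{j=1}^{n-1}(1-q_{\sigma(1)}\cdots q_{\sigma(j)})$, and $\mu(\sigma)=N(\sigma)/D_{\mathbf{q}}(\sigma)$. Subscripts of $q$ are read modulo $n$ (in $\{1,\dots,n\}$), and in (iv) $\sigma(j)$ for $j>n$ means $\sigma$ applied to the representative of $j$ modulo $n$ in $\{1,\dots,n\}$; the empty product ($i=0$) equals $1$. -}

module Defs where

open import Level using (Level; _⊔_) renaming (suc to lsuc)
open import Algebra.Bundles using (CommutativeRing)
open import Data.Bool using (Bool; if_then_else_)
open import Data.Nat using (ℕ; zero; suc; _∸_; _<ᵇ_)
open import Data.Nat.DivMod using (_mod_)
open import Data.Fin using (Fin; toℕ)
open import Data.List using (List; map; foldr; upTo; applyUpTo)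
open import Data.Nat.ListAction using (sum)
open import Relation.Nullary using (¬_)

record Field c ℓ : Set (lsuc (c ⊔ ℓ)) where
  field
    commutativeRing : CommutativeRing c ℓ
  open CommutativeRing commutativeRing public
  field
    0≉1     : ¬ (0# ≈ 1#)
    inv     : (x : Carrier) → ¬ (x ≈ 0#) → Carrier
    inverse : ∀ x (p : ¬ (x ≈ 0#)) → x * inv x p ≈ 1#

iter : ∀ {a} {A : Set a} → ℕ → (A → A) → A → A
iter zero    f x = x
iter (suc i) f x = f (iter i f x)

-- Positions/values are 0-indexed: the paper's index k ∈ {1..n} is
-- Fin n element k-1.  We work with n = suc m ≥ 1.

wrap : (m : ℕ) → ℕ → Fin (suc m)
wrap m k = k mod (suc m)

γ : {m : ℕ} → Fin (suc m) → Fin (suc m)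
γ {m} k = wrap m (suc (toℕ k))

-- identity-like one-line word (for q₁ ⋯ q_i)
idw : {m : ℕ} → Fin (suc m) → Fin (suc m)
idw k = k

-- number of descents etc. only depend on the one-line word of σ;
-- everything below takes σ as a function w : Fin n → Fin n.

-- descent at the paper's position t+1 (t = 0 … n-2): σ(t+1) > σ(t+2)
isDesc : {m : ℕ} → (Fin (suc m) → Fin (suc m)) → ℕ → Bool
isDesc {m} w t = toℕ (w (wrap m (suc t))) <ᵇ toℕ (w (wrap m t))

des : {m : ℕ} → (Fin (suc m) → Fin (suc m)) → ℕ
des {m} w = sum (map (λ t → if isDesc w t then 1 else 0) (upTo m))

cdes : {m : ℕ} → (Fin (suc m) → Fin (suc m)) → ℕ
cdes {m} w = if toℕ (w (wrap m m)) <ᵇ toℕ (w (wrap m 0)) then des w else suc (des w)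

module _ {c ℓ} (F : Field c ℓ) where
  open Field F

  prodL : List Carrier → Carrier
  prodL = foldr _*_ 1#

  pow : Carrier → ℕ → Carrier
  pow x zero    = 1#
  pow x (suc k) = x * pow x k

  -- q_{σ(1)} ⋯ q_{σ(j)}, with σ(k) for k > n read modulo n
  pref : {m : ℕ} → (Fin (suc m) → Carrier) → (Fin (suc m) → Fin (suc m)) → ℕ → Carrier
  pref {m} q w j = prodL (map (λ k → q (w (wrap m k))) (upTo j))

  Nq : {m : ℕ} → (Fin (suc m) → Carrier) → (Fin (suc m) → Fin (suc m)) → Carrier
  Nq {m} q w = prodL (map (λ t → if isDesc w t then pref q w (suc t) else 1#) (upTo m))

  Dq : {m : ℕ} → (Fin (suc m) → Carrier) → (Fin (suc m) → Fin (suc m)) → Carrier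
  Dq {m} q w = prodL (map (λ j → 1# - pref q w j) (applyUpTo suc m))

  μ : {m : ℕ} → (q : Fin (suc m) → Carrier) → (w : Fin (suc m) → Fin (suc m)) →
      ¬ (Dq q w ≈ 0#) → Carrier
  μ q w p = Nq q w * inv (Dq q w) p

{-# OPTIONS --safe #-}
-- Write N(σ) = ∏_{t ∈ D(σ)} P_σ(t) with prefix products P_σ(j) = q_{σ(1)} ⋯ q_{σ(j)},
-- i.e. as a product of powers P_σ(t)^[t ∈ D(σ)], so that comparing descent sets
-- becomes arithmetic on exponents.
--
-- (i) σ with values q ∘ γ and γσ with values q have the same prefix products P. The
-- descent sets of σ and γσ differ only around the position k of the value n: γ creates
-- a descent just before it and removes the one just after it. Hence
-- N_{q∘γ}(σ) · P(k) = N_q(γσ) · P(k+1) = N_q(γσ) · P(k) · q₁, and P(k) is invertible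
-- because q₁ ⋯ qₙ = 1. (ii) holds by definition and (iii) follows by iterating (i).
--
-- (iv) Since P_σ(n) = 1, the wrap-around descent at position n can be added to N(σ)
-- for free. Rotating positions by one divides each prefix product by q_{σ(1)} and
-- shifts the circular descent set cyclically, so N(σ) = q_{σ(1)}^{d̄(σ)} N(σγ);
-- iterating gives (iv).
module Submission where

open import Defs
open import Algebra.Bundles using (CommutativeMonoid)
open import Data.Bool using (Bool; true; false; if_then_else_)
open import Data.Nat as ℕ using (ℕ; zero; suc; _+_; _<_; _<ᵇ_; _≡ᵇ_; z<s; s<s)
open import Data.Nat.Properties
  using (+-0-commutativeMonoid; _<?_; <-cmp; <-irrefl; <⇒≯; <⇒≢; ≤-refl; m<n⇒m<1+n; n≢0⇒n>0; +-identityʳ; +-comm)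
open import Data.Nat.DivMod using (_%_; m<n⇒m%n≡m; [m+n]%n≡m%n; %-distribˡ-+; m%n%n≡m%n; n%n≡0)
open import Data.Fin as Fin using (Fin; toℕ; fromℕ; inject₁)
open import Data.Fin.Properties
  using (toℕ-injective; toℕ-fromℕ<; toℕ<n; toℕ-fromℕ; toℕ-inject₁; fromℕ≢inject₁)
open import Data.Fin.Relation.Unary.Top using (view; ‵fromℕ; ‵inj₁)
open import Data.Fin.Permutation
  using (Permutation′; permutation; _⟨$⟩ʳ_; _⟨$⟩ˡ_; _∘ₚ_; inverseˡ; inverseʳ; transpose)
open import Data.List using (foldr; map; applyUpTo; tabulate; allFin)
open import Data.Product using (_,_)
open import Function.Base using (_∘_; id)
open import Function.Bundles using (mk⇔)
open import Relation.Binary.Definitions using (tri<; tri≈; tri>)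
open import Relation.Nullary using (¬_; yes; no)
open import Relation.Nullary.Decidable using (does; dec-true; dec-false; does-⇔)
open import Relation.Nullary.Negation using (contradiction)
import Relation.Binary.PropositionalEquality as ≡
open ≡ using (_≡_; _≢_)

𝟙 : Bool → ℕ
𝟙 b = if b then 1 else 0

module RangeProduct {c ℓ} (M : CommutativeMonoid c ℓ) where
  open CommutativeMonoid M
  open import Algebra.Properties.CommutativeMonoid.Sum M using (sum)
  open import Algebra.Properties.CommutativeMonoid.Mult M using (_×_; ×-homo-+)
  open import Algebra.Properties.CommutativeSemigroup commutativeSemigroup using (interchange)
  open import Algebra.Definitions _≈_ using (RightInvertible)
  open import Relation.Binary.Reasoning.Setoid setoid

  ∏ : ℕ → (ℕ → Carrier) → Carrier
  ∏ zero    f = ε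
  ∏ (suc n) f = f 0 ∙ ∏ n (f ∘ suc)

  foldr-map-applyUpTo : ∀ n (f : ℕ → Carrier) g → foldr _∙_ ε (map f (applyUpTo g n)) ≡ ∏ n (f ∘ g)
  foldr-map-applyUpTo zero    f g = ≡.refl
  foldr-map-applyUpTo (suc n) f g = ≡.cong (f (g 0) ∙_) (foldr-map-applyUpTo n f (g ∘ suc))

  foldr-map-tabulate : ∀ {a} {A : Set a} n (f : A → Carrier) (g : Fin n → A) →
                       foldr _∙_ ε (map f (tabulate g)) ≡ sum (f ∘ g)
  foldr-map-tabulate zero    f g = ≡.refl
  foldr-map-tabulate (suc n) f g = ≡.cong (f (g Fin.zero) ∙_) (foldr-map-tabulate n f (g ∘ Fin.suc))

  sum≈∏ : ∀ n {f : Fin n → Carrier} {h : ℕ → Carrier} → (∀ i → f i ≈ h (toℕ i)) → sum f ≈ ∏ n h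
  sum≈∏ zero    f≈h = refl
  sum≈∏ (suc n) f≈h = ∙-cong (f≈h Fin.zero) (sum≈∏ n (f≈h ∘ Fin.suc))

  ∏-cong : ∀ n {f g : ℕ → Carrier} → (∀ t → t < n → f t ≈ g t) → ∏ n f ≈ ∏ n g
  ∏-cong zero    f≈g = refl
  ∏-cong (suc n) f≈g = ∙-cong (f≈g 0 z<s) (∏-cong n (λ t t<n → f≈g (suc t) (s<s t<n)))

  ∏-ε : ∀ n → ∏ n (λ _ → ε) ≈ ε
  ∏-ε zero    = refl
  ∏-ε (suc n) = trans (identityˡ _) (∏-ε n)

  ∏-snoc : ∀ n f → ∏ (suc n) f ≈ ∏ n f ∙ f n
  ∏-snoc zero    f = comm (f 0) ε
  ∏-snoc (suc n) f = trans (∙-congˡ (∏-snoc n (f ∘ suc))) (sym (assoc _ _ _))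

  ∏-distrib : ∀ n f g → ∏ n (λ t → f t ∙ g t) ≈ ∏ n f ∙ ∏ n g
  ∏-distrib zero    f g = sym (identityˡ ε)
  ∏-distrib (suc n) f g = trans (∙-congˡ (∏-distrib n (f ∘ suc) (g ∘ suc))) (interchange _ _ _ _)

  ∏-rotate : ∀ n f → f n ≈ f 0 → ∏ n (f ∘ suc) ≈ ∏ n f
  ∏-rotate zero    f _     = refl
  ∏-rotate (suc n) f fn≈f0 = begin
    ∏ (suc n) (f ∘ suc)       ≈⟨ ∏-snoc n (f ∘ suc) ⟩
    ∏ n (f ∘ suc) ∙ f (suc n) ≈⟨ comm _ _ ⟩
    f (suc n) ∙ ∏ n (f ∘ suc) ≈⟨ ∙-congʳ fn≈f0 ⟩
    ∏ (suc n) f               ∎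

  ∏-indicator : ∀ n j (x : ℕ → Carrier) → j < n → ∏ n (λ t → 𝟙 (t ≡ᵇ j) × x t) ≈ x j
  ∏-indicator (suc n) zero    x _         = trans (∙-cong (identityʳ (x 0)) (∏-ε n)) (identityʳ (x 0))
  ∏-indicator (suc n) (suc j) x (s<s j<n) = trans (identityˡ _) (∏-indicator n j (x ∘ suc) j<n)

  ∏-×-+ : ∀ n (a b : ℕ → ℕ) (x : ℕ → Carrier) →
          ∏ n (λ t → (a t + b t) × x t) ≈ ∏ n (λ t → a t × x t) ∙ ∏ n (λ t → b t × x t)
  ∏-×-+ n a b x = trans (∏-cong n (λ t _ → ×-homo-+ (x t) (a t) (b t))) (∏-distrib n _ _)

  if-ε≈𝟙× : ∀ b x → (if b then x else ε) ≈ 𝟙 b × x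
  if-ε≈𝟙× true  x = sym (identityʳ x)
  if-ε≈𝟙× false x = refl

  ∙-invertible : ∀ {x y} → RightInvertible ε _∙_ x → RightInvertible ε _∙_ y → RightInvertible ε _∙_ (x ∙ y)
  ∙-invertible {x} {y} (x⁻¹ , xx⁻¹≈ε) (y⁻¹ , yy⁻¹≈ε) =
    x⁻¹ ∙ y⁻¹ , trans (interchange x y x⁻¹ y⁻¹) (trans (∙-cong xx⁻¹≈ε yy⁻¹≈ε) (identityˡ ε))

  ∏-invertible : ∀ n f → (∀ t → RightInvertible ε _∙_ (f t)) → RightInvertible ε _∙_ (∏ n f)
  ∏-invertible zero    f f-inv = ε , identityˡ ε
  ∏-invertible (suc n) f f-inv = ∙-invertible (f-inv 0) (∏-invertible n (f ∘ suc) (f-inv ∘ suc))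

  cancelʳ-invertible : ∀ {x a b} → RightInvertible ε _∙_ x → a ∙ x ≈ b ∙ x → a ≈ b
  cancelʳ-invertible {x} {a} {b} (x⁻¹ , xx⁻¹≈ε) ax≈bx = begin
    a             ≈⟨ identityʳ a ⟨
    a ∙ ε         ≈⟨ ∙-congˡ xx⁻¹≈ε ⟨
    a ∙ (x ∙ x⁻¹) ≈⟨ assoc a x x⁻¹ ⟨
    (a ∙ x) ∙ x⁻¹ ≈⟨ ∙-congʳ ax≈bx ⟩
    (b ∙ x) ∙ x⁻¹ ≈⟨ assoc b x x⁻¹ ⟩
    b ∙ (x ∙ x⁻¹) ≈⟨ ∙-congˡ xx⁻¹≈ε ⟩
    b ∙ ε         ≈⟨ identityʳ b ⟩
    b             ∎

module ℕ∑ = RangeProduct +-0-commutativeMonoid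

∑ : ℕ → (ℕ → ℕ) → ℕ
∑ = ℕ∑.∏

module RangePower {c ℓ} (M : CommutativeMonoid c ℓ) where
  open CommutativeMonoid M
  open RangeProduct M
  open import Algebra.Properties.CommutativeMonoid.Mult M using (_×_; ×-homo-+; ×-distrib-+)
  open import Relation.Binary.Reasoning.Setoid setoid

  ×-ε : ∀ n {x} → x ≈ ε → n × x ≈ ε
  ×-ε zero    x≈ε = refl
  ×-ε (suc n) x≈ε = trans (∙-cong x≈ε (×-ε n x≈ε)) (identityˡ ε)

  ×-cancelˡ : ∀ n {x y} z → x ∙ y ≈ ε → n × x ∙ (n × y ∙ z) ≈ z
  ×-cancelˡ n {x} {y} z xy≈ε = begin
    n × x ∙ (n × y ∙ z) ≈⟨ assoc _ _ z ⟨
    (n × x ∙ n × y) ∙ z ≈⟨ ∙-congʳ (×-distrib-+ x y n) ⟨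
    n × (x ∙ y) ∙ z     ≈⟨ ∙-congʳ (×-ε n xy≈ε) ⟩
    ε ∙ z               ≈⟨ identityˡ z ⟩
    z                   ∎

  ∏-×-const : ∀ n (a : ℕ → ℕ) x → ∏ n (λ t → a t × x) ≈ ∑ n a × x
  ∏-×-const zero    a x = refl
  ∏-×-const (suc n) a x = trans (∙-congˡ (∏-×-const n (a ∘ suc) x)) (sym (×-homo-+ x (a 0) _))

  ∏-×-∙ : ∀ n (a : ℕ → ℕ) x (y : ℕ → Carrier) →
          ∏ n (λ t → a t × (x ∙ y t)) ≈ ∑ n a × x ∙ ∏ n (λ t → a t × y t)
  ∏-×-∙ n a x y = begin
    ∏ n (λ t → a t × (x ∙ y t))                 ≈⟨ ∏-cong n (λ t _ → ×-distrib-+ x (y t) (a t)) ⟩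
    ∏ n (λ t → a t × x ∙ a t × y t)             ≈⟨ ∏-distrib n _ _ ⟩
    ∏ n (λ t → a t × x) ∙ ∏ n (λ t → a t × y t) ≈⟨ ∙-congʳ (∏-×-const n a x) ⟩
    ∑ n a × x ∙ ∏ n (λ t → a t × y t)           ∎

iter-suc : ∀ {a} {A : Set a} (f : A → A) i x → iter (suc i) f x ≡ iter i f (f x)
iter-suc f zero    x = ≡.refl
iter-suc f (suc i) x = ≡.cong f (iter-suc f i x)

iter-inverse : ∀ {a} {A : Set a} {f g : A → A} → (∀ y → f (g y) ≡ y) → ∀ i y → iter i f (iter i g y) ≡ y
iter-inverse             fg zero    y = ≡.refl
iter-inverse {f = f} {g} fg (suc i) y = begin
  iter (suc i) f (g (iter i g y)) ≡⟨ iter-suc f i _ ⟩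
  iter i f (f (g (iter i g y)))   ≡⟨ ≡.cong (iter i f) (fg _) ⟩
  iter i f (iter i g y)           ≡⟨ iter-inverse fg i y ⟩
  y                               ∎
  where open ≡.≡-Reasoning

if-<ᵇ≡+𝟙 : ∀ {a b} d → a ≢ b → (if a <ᵇ b then d else suc d) ≡ d + 𝟙 (b <ᵇ a)
if-<ᵇ≡+𝟙 {a} {b} d a≢b with <-cmp a b
... | tri< a<b _ _ rewrite dec-true (a <? b) a<b | dec-false (b <? a) (<⇒≯ a<b) = ≡.sym (+-identityʳ d)
... | tri≈ _ a≡b _ = contradiction a≡b a≢b
... | tri> _ _ b<a rewrite dec-false (a <? b) (<⇒≯ b<a) | dec-true (b <? a) b<a = +-comm 1 d

module _ {m : ℕ} where
  open ≡ using (refl; cong; cong₂; trans; sym)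
  open ≡.≡-Reasoning

  toℕ-wrap : ∀ k → toℕ (wrap m k) ≡ k % suc m
  toℕ-wrap k = toℕ-fromℕ< _

  toℕ-wrap< : ∀ {k} → k < suc m → toℕ (wrap m k) ≡ k
  toℕ-wrap< {k} k<n = trans (toℕ-wrap k) (m<n⇒m%n≡m k<n)

  wrap-toℕ : ∀ (x : Fin (suc m)) → wrap m (toℕ x) ≡ x
  wrap-toℕ x = toℕ-injective (toℕ-wrap< (toℕ<n x))

  wrap-periodic : ∀ k → wrap m (k + suc m) ≡ wrap m k
  wrap-periodic k = toℕ-injective (begin
    toℕ (wrap m (k + suc m)) ≡⟨ toℕ-wrap (k + suc m) ⟩
    (k + suc m) % suc m      ≡⟨ [m+n]%n≡m%n k (suc m) ⟩
    k % suc m                ≡⟨ toℕ-wrap k ⟨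
    toℕ (wrap m k)           ∎)

  γ-wrap : ∀ k → γ (wrap m k) ≡ wrap m (suc k)
  γ-wrap k = toℕ-injective (begin
    toℕ (γ (wrap m k))                      ≡⟨ toℕ-wrap (suc (toℕ (wrap m k))) ⟩
    suc (toℕ (wrap m k)) % suc m            ≡⟨ cong (λ r → suc r % suc m) (toℕ-wrap k) ⟩
    (1 + k % suc m) % suc m                 ≡⟨ %-distribˡ-+ 1 (k % suc m) (suc m) ⟩
    (1 % suc m + k % suc m % suc m) % suc m ≡⟨ cong (λ r → (1 % suc m + r) % suc m) (m%n%n≡m%n k (suc m)) ⟩
    (1 % suc m + k % suc m) % suc m         ≡⟨ %-distribˡ-+ 1 k (suc m) ⟨
    suc k % suc m                           ≡⟨ toℕ-wrap (suc k) ⟨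
    toℕ (wrap m (suc k))                    ∎)

  γ-fromℕ : γ (fromℕ m) ≡ Fin.zero
  γ-fromℕ = toℕ-injective (begin
    toℕ (γ (fromℕ m))             ≡⟨ toℕ-wrap (suc (toℕ (fromℕ m))) ⟩
    suc (toℕ (fromℕ m)) % suc m   ≡⟨ cong (λ r → suc r % suc m) (toℕ-fromℕ m) ⟩
    suc m % suc m                 ≡⟨ n%n≡0 (suc m) ⟩
    0                             ∎)

  γ-inject₁ : ∀ (k : Fin m) → γ (inject₁ k) ≡ Fin.suc k
  γ-inject₁ k = toℕ-injective (trans (cong (toℕ ∘ wrap m ∘ suc) (toℕ-inject₁ k)) (toℕ-wrap< (s<s (toℕ<n k))))

  γ⁻¹ : Fin (suc m) → Fin (suc m)
  γ⁻¹ Fin.zero    = fromℕ m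
  γ⁻¹ (Fin.suc k) = inject₁ k

  γ-γ⁻¹ : ∀ y → γ (γ⁻¹ y) ≡ y
  γ-γ⁻¹ Fin.zero    = γ-fromℕ
  γ-γ⁻¹ (Fin.suc k) = γ-inject₁ k

  γ⁻¹-γ : ∀ x → γ⁻¹ (γ x) ≡ x
  γ⁻¹-γ x with view x
  ... | ‵fromℕ          = cong γ⁻¹ γ-fromℕ
  ... | ‵inj₁ {i = k} _ = cong γ⁻¹ (γ-inject₁ k)

  -- Built from iter i γ itself, so that (σ ∘ₚ rotation i) ⟨$⟩ʳ_ is definitionally iter i γ ∘ (σ ⟨$⟩ʳ_).
  rotation : ℕ → Permutation′ (suc m)
  rotation i = permutation (iter i γ) (iter i γ⁻¹) (iter-inverse γ-γ⁻¹ i) (iter-inverse γ⁻¹-γ i)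

  isTop : Fin (suc m) → Bool
  isTop y = does (y Fin.≟ fromℕ m)

  isTop-fromℕ : isTop (fromℕ m) ≡ true
  isTop-fromℕ = dec-true (fromℕ m Fin.≟ fromℕ m) refl

  isTop-inject₁ : ∀ (k : Fin m) → isTop (inject₁ k) ≡ false
  isTop-inject₁ k = dec-false (inject₁ k Fin.≟ fromℕ m) (fromℕ≢inject₁ ∘ sym)

  -- γ creates a descent just before the top value and removes the one just after it.
  descent-γ : ∀ x y → 𝟙 (toℕ x <ᵇ toℕ y) + 𝟙 (isTop x) ≡ 𝟙 (toℕ (γ x) <ᵇ toℕ (γ y)) + 𝟙 (isTop y)
  descent-γ x y with view x | view y
  ... | ‵fromℕ | ‵fromℕ
    rewrite γ-fromℕ | toℕ-fromℕ m | dec-false (m <? m) (<-irrefl refl) = refl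
  ... | ‵fromℕ | ‵inj₁ {i = l} _
    rewrite γ-fromℕ | γ-inject₁ l | toℕ-fromℕ m | toℕ-inject₁ l
          | dec-false (m <? toℕ l) (<⇒≯ (toℕ<n l)) | isTop-fromℕ | isTop-inject₁ l = refl
  ... | ‵inj₁ {i = k} _ | ‵fromℕ
    rewrite γ-inject₁ k | γ-fromℕ | toℕ-fromℕ m | toℕ-inject₁ k
          | dec-true (toℕ k <? m) (toℕ<n k) | isTop-fromℕ | isTop-inject₁ k = refl
  ... | ‵inj₁ {i = k} _ | ‵inj₁ {i = l} _
    rewrite γ-inject₁ k | γ-inject₁ l | toℕ-inject₁ k | toℕ-inject₁ l | isTop-inject₁ k | isTop-inject₁ l = refl

  isTop-position : ∀ (π : Permutation′ (suc m)) {s} → s < suc m →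
                   isTop (π ⟨$⟩ʳ wrap m s) ≡ (s ≡ᵇ toℕ (π ⟨$⟩ˡ fromℕ m))
  isTop-position π {s} s<n =
    does-⇔ (mk⇔ to from) (π ⟨$⟩ʳ wrap m s Fin.≟ fromℕ m) (s ℕ.≟ toℕ (π ⟨$⟩ˡ fromℕ m))
    where
    to : π ⟨$⟩ʳ wrap m s ≡ fromℕ m → s ≡ toℕ (π ⟨$⟩ˡ fromℕ m)
    to e = trans (sym (toℕ-wrap< s<n)) (cong toℕ (trans (sym (inverseˡ π)) (cong (π ⟨$⟩ˡ_) e)))
    from : s ≡ toℕ (π ⟨$⟩ˡ fromℕ m) → π ⟨$⟩ʳ wrap m s ≡ fromℕ m
    from e = trans (cong (λ r → π ⟨$⟩ʳ wrap m r) e) (trans (cong (π ⟨$⟩ʳ_) (wrap-toℕ _)) (inverseʳ π))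

  isDesc-∘γ : ∀ (w : Fin (suc m) → Fin (suc m)) t → isDesc (w ∘ γ) t ≡ isDesc w (suc t)
  isDesc-∘γ w t = cong₂ (λ a b → toℕ (w a) <ᵇ toℕ (w b)) (γ-wrap (suc t)) (γ-wrap t)

  isDesc-periodic : ∀ (w : Fin (suc m) → Fin (suc m)) → isDesc w (suc m) ≡ isDesc w 0
  isDesc-periodic w = cong₂ (λ a b → toℕ (w a) <ᵇ toℕ (w b)) (wrap-periodic 1) (wrap-periodic 0)

  circularDescents : (Fin (suc m) → Fin (suc m)) → ℕ
  circularDescents w = ∑ (suc m) (𝟙 ∘ isDesc w)

  circularDescents-∘γ : ∀ w → circularDescents (w ∘ γ) ≡ circularDescents w
  circularDescents-∘γ w = trans (ℕ∑.∏-cong (suc m) (λ t _ → cong 𝟙 (isDesc-∘γ w t)))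
                                (ℕ∑.∏-rotate (suc m) (𝟙 ∘ isDesc w) (cong 𝟙 (isDesc-periodic w)))

  cdes≡circularDescents : ∀ (π : Permutation′ (suc m)) → 0 < m → cdes (π ⟨$⟩ʳ_) ≡ circularDescents (π ⟨$⟩ʳ_)
  cdes≡circularDescents π 0<m = begin
    cdes w             ≡⟨ if-<ᵇ≡+𝟙 (des w) a≢b ⟩
    des w + 𝟙 (b <ᵇ a) ≡⟨ cong₂ _+_ (ℕ∑.foldr-map-applyUpTo m d id)
                                     (cong (λ r → 𝟙 (toℕ (w r) <ᵇ a)) (sym (wrap-periodic 0))) ⟩
    ∑ m d + d m        ≡⟨ ℕ∑.∏-snoc m d ⟨
    circularDescents w ∎
    where
    w = π ⟨$⟩ʳ_
    d = 𝟙 ∘ isDesc w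
    a = toℕ (w (wrap m m))
    b = toℕ (w (wrap m 0))
    a≢b : a ≢ b
    a≢b a≡b = <⇒≢ 0<m (sym (trans (sym (toℕ-wrap< ≤-refl)) (cong toℕ wrap-m≡wrap-0)))
      where
      wrap-m≡wrap-0 : wrap m m ≡ wrap m 0
      wrap-m≡wrap-0 = trans (sym (inverseˡ π)) (trans (cong (π ⟨$⟩ˡ_) (toℕ-injective a≡b)) (inverseˡ π))

module _ {c ℓ} (M : CommutativeMonoid c ℓ) {m : ℕ} where
  open CommutativeMonoid M
  open RangeProduct M
  open RangePower M
  open import Algebra.Properties.CommutativeMonoid.Mult M using (_×_; ×-congˡ)
  open import Relation.Binary.Reasoning.Setoid setoid

  ∏-before-top : ∀ (π : Permutation′ (suc m)) (x : ℕ → Carrier) → x 0 ≈ ε →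
                 ∏ m (λ t → 𝟙 (isTop (π ⟨$⟩ʳ wrap m (suc t))) × x (suc t)) ≈ x (toℕ (π ⟨$⟩ˡ fromℕ m))
  ∏-before-top π x x0≈ε = begin
    ∏ m (λ t → 𝟙 (isTop (π ⟨$⟩ʳ wrap m (suc t))) × x (suc t))
      ≈⟨ ∏-cong m (λ t t<m → ×-congˡ (≡.cong 𝟙 (isTop-position π (s<s t<m)))) ⟩
    ∏ m (λ t → 𝟙 (suc t ≡ᵇ k) × x (suc t))     ≈⟨ identityˡ _ ⟨
    ε ∙ ∏ m (λ t → 𝟙 (suc t ≡ᵇ k) × x (suc t)) ≈⟨ ∙-congʳ (×-ε (𝟙 (0 ≡ᵇ k)) x0≈ε) ⟨
    ∏ (suc m) (λ s → 𝟙 (s ≡ᵇ k) × x s)         ≈⟨ ∏-indicator (suc m) k x (toℕ<n _) ⟩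
    x k                                          ∎
    where k = toℕ (π ⟨$⟩ˡ fromℕ m)

  ∏-at-top : ∀ (π : Permutation′ (suc m)) (x : ℕ → Carrier) → x (suc m) ≈ ε →
             ∏ m (λ t → 𝟙 (isTop (π ⟨$⟩ʳ wrap m t)) × x (suc t)) ≈ x (suc (toℕ (π ⟨$⟩ˡ fromℕ m)))
  ∏-at-top π x xn≈ε = begin
    ∏ m (λ t → 𝟙 (isTop (π ⟨$⟩ʳ wrap m t)) × x (suc t))
      ≈⟨ ∏-cong m (λ t t<m → ×-congˡ (≡.cong 𝟙 (isTop-position π (m<n⇒m<1+n t<m)))) ⟩
    ∏ m (λ t → 𝟙 (t ≡ᵇ k) × x (suc t))                         ≈⟨ identityʳ _ ⟨
    ∏ m (λ t → 𝟙 (t ≡ᵇ k) × x (suc t)) ∙ ε                     ≈⟨ ∙-congˡ (×-ε (𝟙 (m ≡ᵇ k)) xn≈ε) ⟨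
    ∏ m (λ t → 𝟙 (t ≡ᵇ k) × x (suc t)) ∙ 𝟙 (m ≡ᵇ k) × x (suc m) ≈⟨ ∏-snoc m _ ⟨
    ∏ (suc m) (λ t → 𝟙 (t ≡ᵇ k) × x (suc t))                   ≈⟨ ∏-indicator (suc m) k (x ∘ suc) (toℕ<n _) ⟩
    x (suc k)                                                    ∎
    where k = toℕ (π ⟨$⟩ˡ fromℕ m)

module _ {c ℓ} (F : Field c ℓ) {m : ℕ} where
  open Field F hiding (_+_; zero)
  open RangeProduct *-commutativeMonoid
  open RangePower *-commutativeMonoid
  open import Algebra.Properties.CommutativeMonoid.Mult *-commutativeMonoid
    using (_×_; ×-congʳ; ×-congˡ; ×-homo-+; ×-distrib-+)
  open import Algebra.Properties.CommutativeMonoid.Sum *-commutativeMonoid using (sum; sum-permute)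
  open import Algebra.Properties.CommutativeSemigroup *-commutativeSemigroup using (x∙yz≈zx∙y; x∙yz≈yx∙z)
  open import Algebra.Definitions _≈_ using (RightInvertible)
  open import Relation.Binary.Reasoning.Setoid setoid

  Word : Set
  Word = Fin (suc m) → Fin (suc m)

  totalProduct : (Fin (suc m) → Carrier) → Carrier
  totalProduct f = ∏ (suc m) (f ∘ wrap m)

  sum≈totalProduct : ∀ f → sum f ≈ totalProduct f
  sum≈totalProduct f = sum≈∏ (suc m) {f} {f ∘ wrap m} (λ i → reflexive (≡.cong f (≡.sym (wrap-toℕ i))))

  prodL-allFin : ∀ f → prodL F (map f (allFin (suc m))) ≈ totalProduct f
  prodL-allFin f = trans (reflexive (foldr-map-tabulate (suc m) f id)) (sum≈totalProduct f)

  totalProduct-∘perm : ∀ f (π : Permutation′ (suc m)) → totalProduct (f ∘ (π ⟨$⟩ʳ_)) ≈ totalProduct f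
  totalProduct-∘perm f π = begin
    totalProduct (f ∘ (π ⟨$⟩ʳ_)) ≈⟨ sum≈totalProduct (f ∘ (π ⟨$⟩ʳ_)) ⟨
    sum (f ∘ (π ⟨$⟩ʳ_))          ≈⟨ sum-permute f π ⟨
    sum f                         ≈⟨ sum≈totalProduct f ⟩
    totalProduct f                ∎

  totalProduct-∘γ : ∀ f → totalProduct (f ∘ γ) ≈ totalProduct f
  totalProduct-∘γ f = totalProduct-∘perm f (rotation 1)

  value-invertible : ∀ q → totalProduct q ≈ 1# → ∀ x → RightInvertible 1# _*_ (q x)
  value-invertible q q≈1 x = _ , trans (totalProduct-∘perm q (transpose Fin.zero x)) q≈1

  pref-as-∏ : ∀ q (w : Word) j → pref F q w j ≡ ∏ j (q ∘ w ∘ wrap m)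
  pref-as-∏ q w j = foldr-map-applyUpTo j (q ∘ w ∘ wrap m) id

  pref-total : ∀ q (w : Word) → pref F q w (suc m) ≈ totalProduct (q ∘ w)
  pref-total q w = reflexive (pref-as-∏ q w (suc m))

  pref-suc : ∀ q (w : Word) j → pref F q w (suc j) ≈ pref F q w j * q (w (wrap m j))
  pref-suc q w j = begin
    pref F q w (suc j)                      ≡⟨ pref-as-∏ q w (suc j) ⟩
    ∏ (suc j) (q ∘ w ∘ wrap m)              ≈⟨ ∏-snoc j _ ⟩
    ∏ j (q ∘ w ∘ wrap m) * q (w (wrap m j)) ≡⟨ ≡.cong (_* q (w (wrap m j))) (pref-as-∏ q w j) ⟨
    pref F q w j * q (w (wrap m j))         ∎

  pref-shift : ∀ q (w : Word) j → pref F q w (suc j) ≈ q (w Fin.zero) * pref F q (w ∘ γ) j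
  pref-shift q w j = begin
    pref F q w (suc j)
      ≡⟨ pref-as-∏ q w (suc j) ⟩
    q (w Fin.zero) * ∏ j (q ∘ w ∘ wrap m ∘ suc)
      ≈⟨ *-congˡ (∏-cong j (λ t _ → reflexive (≡.cong (q ∘ w) (≡.sym (γ-wrap t))))) ⟩
    q (w Fin.zero) * ∏ j (q ∘ w ∘ γ ∘ wrap m)
      ≡⟨ ≡.cong (q (w Fin.zero) *_) (pref-as-∏ q (w ∘ γ) j) ⟨
    q (w Fin.zero) * pref F q (w ∘ γ) j ∎

  pref-invertible : ∀ q → totalProduct q ≈ 1# → ∀ (w : Word) j → RightInvertible 1# _*_ (pref F q w j)
  pref-invertible q q≈1 w j = ≡.subst (RightInvertible 1# _*_) (≡.sym (pref-as-∏ q w j))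
    (∏-invertible j _ (λ t → value-invertible q q≈1 (w (wrap m t))))

  Nq-as-∏ : ∀ q (w : Word) → Nq F q w ≈ ∏ m (λ t → 𝟙 (isDesc w t) × pref F q w (suc t))
  Nq-as-∏ q w = trans (reflexive (foldr-map-applyUpTo m _ id))
                      (∏-cong m (λ t _ → if-ε≈𝟙× (isDesc w t) (pref F q w (suc t))))

  Nq-cycleValues : ∀ q → totalProduct q ≈ 1# → (π : Permutation′ (suc m)) →
                   Nq F (q ∘ γ) (π ⟨$⟩ʳ_) ≈ q Fin.zero * Nq F q (γ ∘ (π ⟨$⟩ʳ_))
  Nq-cycleValues q q≈1 π = cancelʳ-invertible (pref-invertible q q≈1 (γ ∘ w) k) (begin
    Nq F (q ∘ γ) w * P k
      ≈⟨ *-cong (Nq-as-∏ (q ∘ γ) w) (sym (∏-before-top *-commutativeMonoid π P refl)) ⟩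
    ∏ m (λ t → a t × P (suc t)) * ∏ m (λ t → u t × P (suc t))
      ≈⟨ ∏-×-+ m a u (P ∘ suc) ⟨
    ∏ m (λ t → (a t + u t) × P (suc t))
      ≈⟨ ∏-cong m (λ t _ → ×-congˡ (descent-γ (w (wrap m (suc t))) (w (wrap m t)))) ⟩
    ∏ m (λ t → (b t + v t) × P (suc t))
      ≈⟨ ∏-×-+ m b v (P ∘ suc) ⟩
    ∏ m (λ t → b t × P (suc t)) * ∏ m (λ t → v t × P (suc t))
      ≈⟨ *-cong (sym (Nq-as-∏ q (γ ∘ w))) (∏-at-top *-commutativeMonoid π P Pn≈1) ⟩
    Nq F q (γ ∘ w) * P (suc k)
      ≈⟨ *-congˡ (pref-suc q (γ ∘ w) k) ⟩
    Nq F q (γ ∘ w) * (P k * q (γ (w (wrap m k))))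
      ≡⟨ ≡.cong (λ y → Nq F q (γ ∘ w) * (P k * q y)) γw₀≡0 ⟩
    Nq F q (γ ∘ w) * (P k * q Fin.zero)
      ≈⟨ x∙yz≈zx∙y _ _ _ ⟩
    q Fin.zero * Nq F q (γ ∘ w) * P k ∎)
    where
    w = π ⟨$⟩ʳ_
    k = toℕ (π ⟨$⟩ˡ fromℕ m)
    P = pref F q (γ ∘ w)
    a b u v : ℕ → ℕ
    a t = 𝟙 (isDesc w t)
    b t = 𝟙 (isDesc (γ ∘ w) t)
    u t = 𝟙 (isTop (w (wrap m (suc t))))
    v t = 𝟙 (isTop (w (wrap m t)))
    Pn≈1 : P (suc m) ≈ 1#
    Pn≈1 = trans (pref-total q (γ ∘ w))
                 (trans (totalProduct-∘perm (q ∘ γ) π) (trans (totalProduct-∘γ q) q≈1))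
    γw₀≡0 : γ (w (wrap m k)) ≡ Fin.zero
    γw₀≡0 = ≡.trans (≡.cong (γ ∘ (π ⟨$⟩ʳ_)) (wrap-toℕ _)) (≡.trans (≡.cong γ (inverseʳ π)) γ-fromℕ)

  Nq-cycleValues-iter : ∀ i q → totalProduct q ≈ 1# → (σ : Permutation′ (suc m)) →
                        Nq F (q ∘ iter i γ) (σ ⟨$⟩ʳ_) ≈ pref F q idw i * Nq F q (iter i γ ∘ (σ ⟨$⟩ʳ_))
  Nq-cycleValues-iter zero    q q≈1 σ = sym (*-identityˡ _)
  Nq-cycleValues-iter (suc i) q q≈1 σ = begin
    Nq F (q ∘ γ ∘ iter i γ) (σ ⟨$⟩ʳ_)
      ≈⟨ Nq-cycleValues-iter i (q ∘ γ) (trans (totalProduct-∘γ q) q≈1) σ ⟩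
    pref F (q ∘ γ) idw i * Nq F (q ∘ γ) w
      ≈⟨ *-congˡ (Nq-cycleValues q q≈1 (σ ∘ₚ rotation i)) ⟩
    pref F (q ∘ γ) idw i * (q Fin.zero * Nq F q (γ ∘ w))
      ≈⟨ x∙yz≈yx∙z _ _ _ ⟩
    q Fin.zero * pref F (q ∘ γ) idw i * Nq F q (γ ∘ w)
      ≈⟨ *-congʳ (pref-shift q idw i) ⟨
    pref F q idw (suc i) * Nq F q (γ ∘ w) ∎
    where w = iter i γ ∘ (σ ⟨$⟩ʳ_)

  inv-irrelevant : ∀ {x} (p p′ : ¬ x ≈ 0#) → inv x p ≈ inv x p′
  inv-irrelevant {x} p p′ = cancelʳ-invertible (inv x p , inverse x p)
    (trans (*-comm _ _) (trans (inverse x p) (sym (trans (*-comm _ _) (inverse x p′)))))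

  μ-cycleValues-iter : ∀ i q → totalProduct q ≈ 1# → (σ : Permutation′ (suc m)) →
                       (p₁ : ¬ Dq F (q ∘ iter i γ) (σ ⟨$⟩ʳ_) ≈ 0#) (p₂ : ¬ Dq F q (iter i γ ∘ (σ ⟨$⟩ʳ_)) ≈ 0#) →
                       μ F (q ∘ iter i γ) (σ ⟨$⟩ʳ_) p₁ ≈ pref F q idw i * μ F q (iter i γ ∘ (σ ⟨$⟩ʳ_)) p₂
  μ-cycleValues-iter i q q≈1 σ p₁ p₂ =
    trans (*-cong (Nq-cycleValues-iter i q q≈1 σ) (inv-irrelevant p₁ p₂)) (*-assoc _ _ _)

  Nq-cyclePositions : ∀ q (w : Word) → totalProduct (q ∘ w) ≈ 1# →
                      Nq F q w ≈ circularDescents w × q (w Fin.zero) * Nq F q (w ∘ γ)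
  Nq-cyclePositions q w qw≈1 = begin
    Nq F q w
      ≈⟨ Nq-as-∏ q w ⟩
    ∏ m (λ t → d t × P (suc t))
      ≈⟨ *-identityʳ _ ⟨
    ∏ m (λ t → d t × P (suc t)) * 1#
      ≈⟨ *-congˡ (×-ε (d m) (trans (pref-total q w) qw≈1)) ⟨
    ∏ m (λ t → d t × P (suc t)) * d m × P (suc m)
      ≈⟨ ∏-snoc m _ ⟨
    d 0 × P 1 * ∏ m (λ t → d (suc t) × P (suc (suc t)))
      ≈⟨ *-cong (×-congʳ (d 0) (*-identityʳ x))
                (∏-cong m (λ t _ → ×-congʳ (d (suc t)) (pref-shift q w (suc t)))) ⟩
    d 0 × x * ∏ m (λ t → d (suc t) × (x * P′ (suc t)))
      ≈⟨ *-congˡ (∏-×-∙ m (d ∘ suc) x (P′ ∘ suc)) ⟩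
    d 0 × x * (∑ m (d ∘ suc) × x * ∏ m (λ t → d (suc t) × P′ (suc t)))
      ≈⟨ *-assoc _ _ _ ⟨
    (d 0 × x * ∑ m (d ∘ suc) × x) * ∏ m (λ t → d (suc t) × P′ (suc t))
      ≈⟨ *-cong (×-homo-+ x (d 0) _) (∏-cong m (λ t _ → ×-congˡ (≡.cong 𝟙 (isDesc-∘γ w t)))) ⟨
    circularDescents w × x * ∏ m (λ t → 𝟙 (isDesc (w ∘ γ) t) × P′ (suc t))
      ≈⟨ *-congˡ (Nq-as-∏ q (w ∘ γ)) ⟨
    circularDescents w × x * Nq F q (w ∘ γ) ∎
    where
    x = q (w Fin.zero)
    d = 𝟙 ∘ isDesc w
    P = pref F q w
    P′ = pref F q (w ∘ γ)

  Nq-cyclePositions-iter : ∀ i q (w : Word) → totalProduct (q ∘ w) ≈ 1# →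
                           Nq F q w ≈ circularDescents w × pref F q w i * Nq F q (w ∘ iter i γ)
  Nq-cyclePositions-iter zero    q w qw≈1 = sym (trans (*-congʳ (×-ε (circularDescents w) refl)) (*-identityˡ _))
  Nq-cyclePositions-iter (suc i) q w qw≈1 = begin
    Nq F q w
      ≈⟨ Nq-cyclePositions q w qw≈1 ⟩
    C × x * Nq F q (w ∘ γ)
      ≈⟨ *-congˡ (Nq-cyclePositions-iter i q (w ∘ γ) (trans (totalProduct-∘γ (q ∘ w)) qw≈1)) ⟩
    C × x * (circularDescents (w ∘ γ) × P′ * N)
      ≡⟨ ≡.cong (λ c → C × x * (c × P′ * N)) (circularDescents-∘γ w) ⟩
    C × x * (C × P′ * N)
      ≈⟨ *-assoc _ _ _ ⟨
    C × x * C × P′ * N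
      ≈⟨ *-congʳ (×-distrib-+ x P′ C) ⟨
    C × (x * P′) * N
      ≈⟨ *-congʳ (×-congʳ C (pref-shift q w i)) ⟨
    C × pref F q w (suc i) * N ∎
    where
    C = circularDescents w
    x = q (w Fin.zero)
    P′ = pref F q (w ∘ γ) i
    N = Nq F q (w ∘ iter (suc i) γ)

  pow≡× : ∀ x k → pow F x k ≡ k × x
  pow≡× x zero    = ≡.refl
  pow≡× x (suc k) = ≡.cong (x *_) (pow≡× x k)

  Nq-rotatePositions-n>1 : ∀ q → totalProduct q ≈ 1# → (σ : Permutation′ (suc m)) → 0 < m →
                           ∀ i (p : ¬ pref F q (σ ⟨$⟩ʳ_) i ≈ 0#) →
                           Nq F q ((σ ⟨$⟩ʳ_) ∘ iter i γ) ≈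
                             pow F (inv (pref F q (σ ⟨$⟩ʳ_) i) p) (cdes (σ ⟨$⟩ʳ_)) * Nq F q (σ ⟨$⟩ʳ_)
  Nq-rotatePositions-n>1 q q≈1 σ 0<m i p = sym (begin
    pow F I (cdes w) * Nq F q w
      ≡⟨ ≡.cong (_* Nq F q w) (pow≡× I (cdes w)) ⟩
    cdes w × I * Nq F q w
      ≡⟨ ≡.cong (λ c → c × I * Nq F q w) (cdes≡circularDescents σ 0<m) ⟩
    C × I * Nq F q w
      ≈⟨ *-congˡ (Nq-cyclePositions-iter i q w (trans (totalProduct-∘perm q σ) q≈1)) ⟩
    C × I * (C × P * Nq F q (w ∘ iter i γ))
      ≈⟨ ×-cancelˡ C _ (trans (*-comm I P) (inverse P p)) ⟩
    Nq F q (w ∘ iter i γ) ∎)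
    where
    w = σ ⟨$⟩ʳ_
    P = pref F q w i
    I = inv P p
    C = circularDescents w

  -- For n = 1, cdes is 1 rather than the paper's d̄ = 0; this is harmless since then q₁ = 1.
  Nq-rotatePositions-n≡1 : m ≡ 0 → ∀ q → totalProduct q ≈ 1# → ∀ (w : Word) i (p : ¬ pref F q w i ≈ 0#) k →
                           Nq F q (w ∘ iter i γ) ≈ pow F (inv (pref F q w i) p) k * Nq F q w
  Nq-rotatePositions-n≡1 ≡.refl q q≈1 w i p k =
    sym (trans (*-identityʳ _) (trans (reflexive (pow≡× I k)) (×-ε k I≈1)))
    where
    P = pref F q w i
    I = inv P p
    q≈1′ : ∀ y → q y ≈ 1#
    q≈1′ Fin.zero = trans (sym (*-identityʳ _)) q≈1
    P≈1 : P ≈ 1#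
    P≈1 = trans (reflexive (pref-as-∏ q w i)) (trans (∏-cong i (λ t _ → q≈1′ _)) (∏-ε i))
    I≈1 : I ≈ 1#
    I≈1 = trans (sym (trans (*-congʳ P≈1) (*-identityˡ I))) (inverse P p)

  Nq-rotatePositions : ∀ q → totalProduct q ≈ 1# → (σ : Permutation′ (suc m)) →
                       ∀ i (p : ¬ pref F q (σ ⟨$⟩ʳ_) i ≈ 0#) →
                       Nq F q ((σ ⟨$⟩ʳ_) ∘ iter i γ) ≈
                         pow F (inv (pref F q (σ ⟨$⟩ʳ_) i) p) (cdes (σ ⟨$⟩ʳ_)) * Nq F q (σ ⟨$⟩ʳ_)
  Nq-rotatePositions q q≈1 σ i p with m ℕ.≟ 0
  ... | yes m≡0 = Nq-rotatePositions-n≡1 m≡0 q q≈1 (σ ⟨$⟩ʳ_) i p (cdes (σ ⟨$⟩ʳ_))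
  ... | no  m≢0 = Nq-rotatePositions-n>1 q q≈1 σ (n≢0⇒n>0 m≢0) i p

-- Imported only here: above, _×_ is the monoid power n × x.
open import Data.Product using (_×_)

lemma3p1 : ∀ {c ℓ} (F : Field c ℓ) (m : ℕ)
    (q : Fin (suc m) → Field.Carrier F) →
    Field._≈_ F (prodL F (map q (allFin (suc m)))) (Field.1# F) →
    (σ τ : Permutation′ (suc m)) (i : ℕ) →
    let open Field F in
    (Nq F (q ∘ γ) (σ ⟨$⟩ʳ_) ≈ q Fin.zero * Nq F q (γ ∘ (σ ⟨$⟩ʳ_)))
    × (Dq F (q ∘ (τ ⟨$⟩ʳ_)) (σ ⟨$⟩ʳ_) ≈ Dq F q ((τ ⟨$⟩ʳ_) ∘ (σ ⟨$⟩ʳ_)))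
    × (∀ (p₁ : ¬ (Dq F (q ∘ iter i γ) (σ ⟨$⟩ʳ_) ≈ 0#))
         (p₂ : ¬ (Dq F q (iter i γ ∘ (σ ⟨$⟩ʳ_)) ≈ 0#)) →
         μ F (q ∘ iter i γ) (σ ⟨$⟩ʳ_) p₁ ≈ pref F q idw i * μ F q (iter i γ ∘ (σ ⟨$⟩ʳ_)) p₂)
    × (∀ (p : ¬ (pref F q (σ ⟨$⟩ʳ_) i ≈ 0#)) →
         Nq F q ((σ ⟨$⟩ʳ_) ∘ iter i γ) ≈ pow F (inv (pref F q (σ ⟨$⟩ʳ_) i) p) (cdes (σ ⟨$⟩ʳ_)) * Nq F q (σ ⟨$⟩ʳ_))
lemma3p1 F m q allFin≈1 σ τ i =
    Nq-cycleValues F q q≈1 σ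
  , Field.refl F
  , μ-cycleValues-iter F i q q≈1 σ
  , Nq-rotatePositions F q q≈1 σ i
  where
  q≈1 : Field._≈_ F (totalProduct F q) (Field.1# F)
  q≈1 = Field.trans F (Field.sym F (prodL-allFin F q)) allFin≈1
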